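{- For every tree $t$ there is a tree $t^*\in T$ which is strongly extensional, compactly branching, and Barr-equivalent to $t$ (i.e. $\partial_n(t^*)=\partial_n(t)$ for all $n<\omega$).
   Context: A tree is a directed graph with a root from which every node is reachable by a unique directed path; trees are unordered and identified up to isomorphism. Tree bisimulation between $t,u$: relation $R$ on nodes with (a) if $xRy$, every child of $x$ is related to some child of $y$ and vice versa; (b) roots are related to each other and to no other nodes; (c) related nodes have related parents. $t$ is strongly extensional if every tree bisimulation on $t$ is contained in the diagonal. Let $\mathcal{P}_f$ be the finite power set functor; $\mathcal{P}_f^0 1=\{*\}$, $\mathcal{P}_f^{n+1}1=\mathcal{P}_f(\mathcal{P}_f^n1)$, with maps $\mathcal{P}_f^n!\colon\mathcal{P}_f^{n+1}1\to\mathcal{P}_f^n1$ ($!$ the unique map to $1$, $\mathcal{P}_f^{n+1}!=\mathcal{P}_f(\mathcal{P}_f^n!)$ acting by direct image). $V_\omega$ is the set of sequences $x=(x_n)_{n<\omega}$ with $x_n\in\mathcal{P}_f^n1$ and $\mathcal{P}_f^n!(x_{n+1})=x_n$. For a tree $t$ define $\rho^t_n\colon t\to\mathcal{P}_f^n1$ by $\rho^t_0(x)=*$, $\rho^t_{n+1}(x)=\{\rho^t_n(y): y \text{ a child of } x\}$, and $\partial_n(t)=\rho^t_n(\mathrm{root}(t))$. For nodes $x_0,x_1,\dots,y$ of $t$, write $\lim x_n=y$ if for every $n$ there is $m$ with $\rho^t_n(x_p)=\rho^t_n(y)$ for all $p\ge m$. $t$ is compactly branching if for each node $x$ and each sequence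 $(y_n)$ of children of $x$ there is a subsequence $(w_n)$ and a child $z$ of $x$ with $\lim w_n=z$. For $x,y\in V_\omega$ write $x\leadsto y$ iff $y_n\in x_{n+1}$ for all $n$. For $x\in V_\omega$, $\mathsf{tr}_x$ is the tree whose nodes are the finite sequences $\langle x^1,\dots,x^k\rangle$ ($k\ge1$) of elements of $V_\omega$ with $x^1=x$ and $x^i\leadsto x^{i+1}$ for all $i<k$, with root $\langle x\rangle$ and with an edge from $\langle x^1,\dots,x^k\rangle$ to each $\langle x^1,\dots,x^k,y\rangle$. $T=\{\mathsf{tr}_x: x\in V_\omega\}$. -}

module Defs where

open import Level using (0ℓ)
open import Data.Unit using (⊤; tt)
open import Data.Nat using (ℕ; zero; suc; _<_; _≥_)
open import Data.Product using (Σ; ∃; _×_; _,_; proj₁; proj₂)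
open import Data.List using (List; []; _∷_; _∷ʳ_)
import Data.List as List
open import Data.List.Relation.Unary.Any using (Any)
open import Data.List.Relation.Unary.All using (All)
open import Data.List.Relation.Binary.Pointwise using (Pointwise)
open import Relation.Binary.Structures using (IsEquivalence)
open import Function.Bundles using (_⇔_)

record RGraph : Set₁ where
  field
    Node : Set
    _≐_  : Node → Node → Set
    root : Node
    Edge : Node → Node → Set          -- Edge x y : y is a child of x

module _ (G : RGraph) where
  open RGraph G

  data Path : Node → Node → Set where
    stop : ∀ {x y} → x ≐ y → Path x y
    step : ∀ {x y z} → Edge x y → Path y z → Path x z

  pathNodes : ∀ {x z} → Path x z → List Node
  pathNodes (stop _) = []
  pathNodes (step {y = y} _ p) = y ∷ pathNodes p

  IsTree : Set
  IsTree =
    IsEquivalence _≐_ ×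
    (∀ {x x′ y y′} → x ≐ x′ → y ≐ y′ → Edge x y → Edge x′ y′) ×
    (∀ y → Path root y) ×
    (∀ y (p q : Path root y) → Pointwise _≐_ (pathNodes p) (pathNodes q))

-- Iterated finite power set of 1 (hereditarily finite sets of rank ≤ n),
-- finite sets represented by lists, with extensional set equality _≈_

PF : ℕ → Set
PF zero    = ⊤
PF (suc n) = List (PF n)

_≈_ : ∀ {n} → PF n → PF n → Set
_≈_ {zero}  _  _  = ⊤
_≈_ {suc n} xs ys = All (λ a → Any (a ≈_) ys) xs × All (λ b → Any (_≈ b) xs) ys

-- P_f^n ! : P_f^{n+1} 1 → P_f^n 1  (direct image)
bang : ∀ n → PF (suc n) → PF n
bang zero    _  = tt
bang (suc n) xs = List.map (bang n) xs

_∈PF_ : ∀ {n} → PF n → PF (suc n) → Set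
a ∈PF xs = Any (a ≈_) xs

record Vω : Set where
  field
    seq : (n : ℕ) → PF n
    coh : ∀ n → bang n (seq (suc n)) ≈ seq n
open Vω public

_≈ω_ : Vω → Vω → Set
x ≈ω y = ∀ n → seq x n ≈ seq y n

_⇝_ : Vω → Vω → Set
x ⇝ y = ∀ n → seq y n ∈PF seq x (suc n)

-- chains x ⇝ x² ⇝ ... ⇝ xᵏ, recorded as the list [x², ..., xᵏ]
Chain : Vω → List Vω → Set
Chain x []       = ⊤
Chain x (y ∷ ys) = (x ⇝ y) × Chain y ys

-- the tree tr_x: node ⟨x, x², ..., xᵏ⟩ is represented by ([x², ..., xᵏ] , chain proof)
tr : Vω → RGraph
tr x = record
  { Node = Σ (List Vω) (Chain x)
  ; _≐_  = λ u v → Pointwise _≈ω_ (proj₁ u) (proj₁ v)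
  ; root = [] , tt
  ; Edge = λ u v → ∃ λ y → Pointwise _≈ω_ (proj₁ v) (proj₁ u ∷ʳ y)
  }

-- ρ_n, written as a relation:  Rho G n x s  ⟺  ρ_n(x) = s  (as sets)

module _ (G : RGraph) where
  open RGraph G

  Rho : (n : ℕ) → Node → PF n → Set
  Rho zero    x s = ⊤
  Rho (suc n) x s =
    (∀ y → Edge x y → Any (Rho n y) s) ×
    All (λ a → ∃ λ y → Edge x y × Rho n y a) s

  SameRho : ℕ → Node → Node → Set
  SameRho n u v = ∀ s → Rho n u s ⇔ Rho n v s

  Lim : (ℕ → Node) → Node → Set
  Lim xs y = ∀ n → ∃ λ m → ∀ p → p ≥ m → SameRho n (xs p) y

  CompactlyBranching : Set
  CompactlyBranching =
    ∀ x (ys : ℕ → Node) → (∀ n → Edge x (ys n)) →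
    Σ (ℕ → ℕ) λ f → (∀ k → f k < f (suc k)) ×
      ∃ λ z → Edge x z × Lim (λ k → ys (f k)) z

  IsTreeBisim : (Node → Node → Set) → Set
  IsTreeBisim R =
    (∀ x y → R x y → ∀ x′ → Edge x x′ → ∃ λ y′ → Edge y y′ × R x′ y′) ×
    (∀ x y → R x y → ∀ y′ → Edge y y′ → ∃ λ x′ → Edge x x′ × R x′ y′) ×
    R root root ×
    (∀ y → R root y → y ≐ root) ×
    (∀ x → R x root → x ≐ root) ×
    (∀ x y px py → R x y → Edge px x → Edge py y → R px py)

  StronglyExtensional : Set₁
  StronglyExtensional =
    (R : Node → Node → Set) → IsTreeBisim R → ∀ x y → R x y → x ≐ y

BarrEquivalent : RGraph → RGraph → Set
BarrEquivalent t u =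
  ∀ n (s : PF n) → Rho t n (RGraph.root t) s ⇔ Rho u n (RGraph.root u) s

module Submission where

-- Classically each ρₙ(u) exists, since PF n is finite up to ≈, so the values
-- ∂ₙ(t) form a point x of Vω, and we take t* = tr x.  In tr x the node
-- ⟨x, …, xᵏ⟩ has ρₙ = xᵏₙ: one inclusion is the definition of ⇝, the other is
-- the lifting property of Vω (every element of aₙ₊₁ is yₙ for some y with
-- a ⇝ y).  Hence tr x is Barr-equivalent to t.  Nodes related by a tree
-- bisimulation have equal ρ, hence equal last components, and related parents,
-- so by induction on depth they coincide.  Finally a pigeonhole argument over
-- the finite sets PF n extracts from any sequence of children of u a subsequence
-- converging to a point c with end u ⇝ c, which is again a child of u.

open import Defs
open import Data.Unit using (tt)
open import Level using (0ℓ)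
open import Data.Bool using (true; false)
open import Data.Empty using (⊥-elim)
open import Data.Nat using (ℕ; zero; suc; _+_; _⊔_; _<_; _≥_; _≤′_; ≤′-refl; ≤′-step)
open import Data.Nat.Properties using (+-comm; suc-injective; ≡-irrelevant; ≤-refl; ≤-trans; m≤m⊔n; m≤n⊔m; ≤⇒≤′)
open import Data.Product using (Σ; ∃; _×_; _,_; proj₁; proj₂)
open import Data.List using (List; []; _∷_; _∷ʳ_; _++_; map; filter; length; initLast; _∷ʳ′_)
open import Data.List.Properties using (++-assoc; ++-identityʳ; length-++-comm)
open import Data.List.Relation.Binary.Pointwise using (Pointwise; []; _∷_)
import Data.List.Relation.Binary.Pointwise as Pointwise
open import Data.List.Relation.Unary.Any using (Any; here; there)
import Data.List.Relation.Unary.Any as Any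
import Data.List.Relation.Unary.Any.Properties as Any
open import Data.List.Relation.Unary.All using (All; []; _∷_)
import Data.List.Relation.Unary.All as All
import Data.List.Relation.Unary.All.Properties as All
open import Data.List.Membership.Propositional using (_∈_; find; lose)
open import Data.List.Membership.Propositional.Properties using (∈-map⁺; ∈-++⁺ˡ; ∈-++⁺ʳ; ∈-filter⁺)
open import Relation.Nullary using (¬_; yes; no; does)
open import Relation.Unary using (Decidable)
open import Axiom.ExcludedMiddle using (ExcludedMiddle)
open import Axiom.DoubleNegationElimination using (em⇒dne)
open import Relation.Binary.Definitions using (_Respects_)
open import Relation.Binary.Structures using (IsEquivalence)
import Relation.Binary.Construct.On as On
open import Relation.Binary.PropositionalEquality using (_≡_; refl; sym; trans; cong; subst; subst₂)
open import Function.Bundles using (mk⇔)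

≈-refl : ∀ {n} {a : PF n} → a ≈ a
≈-refl {zero}  = tt
≈-refl {suc n} = All.tabulate (Any.map λ { refl → ≈-refl }) , All.tabulate (Any.map λ { refl → ≈-refl })

≈-sym : ∀ {n} {a b : PF n} → a ≈ b → b ≈ a
≈-sym {zero}  _       = tt
≈-sym {suc n} (f , g) = All.map (Any.map ≈-sym) g , All.map (Any.map ≈-sym) f

≈-trans : ∀ {n} {a b c : PF n} → a ≈ b → b ≈ c → a ≈ c
≈-trans {zero}  _       _         = tt
≈-trans {suc n} (f , g) (f′ , g′) =
  All.map (λ a∈b → let b∈c , a≈b = All.lookupAny f′ a∈b in Any.map (≈-trans a≈b) b∈c) f ,
  All.map (λ c∈b → let b∈a , b≈c = All.lookupAny g c∈b in Any.map (λ a≈b → ≈-trans a≈b b≈c) b∈a) g′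

Any-resp-⊆ : ∀ {n} {P : PF n → Set} {xs ys : PF (suc n)} →
  P Respects _≈_ → All (_∈PF ys) xs → Any P xs → Any P ys
Any-resp-⊆ resp xs⊆ys pxs = let x∈ys , px = All.lookupAny xs⊆ys pxs in Any.map (λ x≈y → resp x≈y px) x∈ys

All-resp-⊇ : ∀ {n} {P : PF n → Set} {xs ys : PF (suc n)} →
  P Respects _≈_ → All (λ y → Any (_≈ y) xs) ys → All P xs → All P ys
All-resp-⊇ resp ys⊆xs pxs = All.map (λ y∈xs → let px , x≈y = All.lookupAny pxs y∈xs in resp x≈y px) ys⊆xs

∈PF-resp : ∀ {n} {a b : PF n} {xs ys : PF (suc n)} → a ≈ b → xs ≈ ys → a ∈PF xs → b ∈PF ys
∈PF-resp a≈b (xs⊆ys , _) a∈xs = Any-resp-⊆ (λ x≈y b≈x → ≈-trans b≈x x≈y) xs⊆ys (Any.map (≈-trans (≈-sym a≈b)) a∈xs)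

bang-cong : ∀ n {a b : PF (suc n)} → a ≈ b → bang n a ≈ bang n b
bang-cong zero    _       = tt
bang-cong (suc n) (f , g) = All.map⁺ (All.map (λ a∈ → Any.map⁺ (Any.map (bang-cong n) a∈)) f) ,
                            All.map⁺ (All.map (λ b∈ → Any.map⁺ (Any.map (bang-cong n) b∈)) g)

bang-∈PF : ∀ n {a : PF (suc n)} {xs : PF (suc (suc n))} → a ∈PF xs → bang n a ∈PF bang (suc n) xs
bang-∈PF n a∈xs = Any.map⁺ (Any.map (bang-cong n) a∈xs)

≈-reflexive : ∀ {n} {a b : PF n} → a ≡ b → a ≈ b
≈-reflexive refl = ≈-refl

seq-bang-∈PF : (a : Vω) (n : ℕ) {c : PF (suc n)} → c ∈PF seq a (suc (suc n)) → bang n c ∈PF seq a (suc n)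
seq-bang-∈PF a n c∈ = ∈PF-resp ≈-refl (coh a (suc n)) (bang-∈PF n c∈)

seq-lift : (a : Vω) (n : ℕ) {z : PF n} → z ∈PF seq a (suc n) →
  ∃ λ (w : PF (suc n)) → w ∈PF seq a (suc (suc n)) × bang n w ≈ z
seq-lift a n z∈ with All.lookupAny (proj₂ (coh a (suc n))) z∈
... | w′∈ , z≈ with find (Any.map⁻ w′∈)
... | w , w∈ , bw≈ = w , Any.map (λ { refl → ≈-refl }) w∈ , ≈-trans bw≈ (≈-sym z≈)

trunc : ∀ j {m L} → j + m ≡ L → PF L → PF m
trunc zero    refl c = c
trunc (suc j) {L = zero}  () _
trunc (suc j) {L = suc L} eq c = trunc j (suc-injective eq) (bang L c)

trunc-cong : ∀ j {m L} (eq : j + m ≡ L) {c c′ : PF L} → c ≈ c′ → trunc j eq c ≈ trunc j eq c′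
trunc-cong zero    refl c≈c′ = c≈c′
trunc-cong (suc j) {L = zero}  () _
trunc-cong (suc j) {L = suc L} eq c≈c′ = trunc-cong j (suc-injective eq) (bang-cong L c≈c′)

bang-trunc : ∀ j {m L} (e₁ : j + suc m ≡ suc L) (e₀ : j + m ≡ L) (c : PF (suc L)) →
  bang m (trunc j e₁ c) ≡ trunc j e₀ (bang L c)
bang-trunc zero    e₁ refl c rewrite ≡-irrelevant e₁ refl = refl
bang-trunc (suc j) {L = zero}  _  () _
bang-trunc (suc j) {L = suc L} e₁ e₀ c = bang-trunc j (suc-injective e₁) (suc-injective e₀) (bang (suc L) c)

trunc-∈PF : (a : Vω) (j : ℕ) {m L : ℕ} (eq : j + m ≡ L) {c : PF L} →
  c ∈PF seq a (suc L) → trunc j eq c ∈PF seq a (suc m)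
trunc-∈PF a zero    refl c∈ = c∈
trunc-∈PF a (suc j) {L = zero}  () _
trunc-∈PF a (suc j) {L = suc L} eq c∈ = trunc-∈PF a j (suc-injective eq) (seq-bang-∈PF a L c∈)

module Lift (a : Vω) (n : ℕ) (e : PF n) (e∈ : e ∈PF seq a (suc n)) where

  tower : ∀ k → Σ (PF (k + n)) (_∈PF seq a (suc (k + n)))
  tower zero    = e , e∈
  tower (suc k) = let w , w∈ , _ = seq-lift a (k + n) (proj₂ (tower k)) in w , w∈

  tower-bang : ∀ k → bang (k + n) (proj₁ (tower (suc k))) ≈ proj₁ (tower k)
  tower-bang k = proj₂ (proj₂ (seq-lift a (k + n) (proj₂ (tower k))))

  thread : Vω
  seq thread m = trunc n (+-comm n m) (proj₁ (tower m))
  coh thread m = ≈-trans (≈-reflexive (bang-trunc n (+-comm n (suc m)) (+-comm n m) (proj₁ (tower (suc m)))))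
                         (trunc-cong n (+-comm n m) (tower-bang m))

  trunc-tower : ∀ k (eq : k + n ≡ k + n) → trunc k eq (proj₁ (tower k)) ≈ e
  trunc-tower zero    eq rewrite ≡-irrelevant eq refl = ≈-refl
  trunc-tower (suc k) eq = ≈-trans (trunc-cong k _ (tower-bang k)) (trunc-tower k (suc-injective eq))

⇝-lift : (a : Vω) (n : ℕ) {e : PF n} → e ∈PF seq a (suc n) → ∃ λ y → a ⇝ y × seq y n ≈ e
⇝-lift a n e∈ = thread , (λ m → trunc-∈PF a n (+-comm n m) (proj₂ (tower m))) , trunc-tower n (+-comm n n)
  where open Lift a n _ e∈

≈ω-isEquivalence : IsEquivalence _≈ω_
≈ω-isEquivalence = record
  { refl  = λ _ → ≈-refl
  ; sym   = λ x≈y n → ≈-sym (x≈y n)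
  ; trans = λ x≈y y≈z n → ≈-trans (x≈y n) (y≈z n)
  }

⇝-resp : ∀ {x x′ y y′} → x ≈ω x′ → y ≈ω y′ → x ⇝ y → x′ ⇝ y′
⇝-resp x≈x′ y≈y′ x⇝y n = ∈PF-resp (y≈y′ n) (x≈x′ (suc n)) (x⇝y n)

≈-below : ∀ (y z : Vω) {n m} → n ≤′ m → seq y m ≈ seq z m → seq y n ≈ seq z n
≈-below y z ≤′-refl         yₘ≈zₘ = yₘ≈zₘ
≈-below y z (≤′-step n≤′m) yₘ≈zₘ =
  ≈-below y z n≤′m (≈-trans (≈-sym (coh y _)) (≈-trans (bang-cong _ yₘ≈zₘ) (coh z _)))

module RhoProperties (G : RGraph) where
  open RGraph G

  Rho-resp : ∀ n {u} → Rho G n u Respects _≈_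
  Rho-resp zero    _                   _       = tt
  Rho-resp (suc n) (xs⊆ys , ys⊆xs) (f , g) =
    (λ y e → Any-resp-⊆ (Rho-resp n) xs⊆ys (f y e)) ,
    All-resp-⊇ (λ { s≈s′ (y , e , r) → y , e , Rho-resp n s≈s′ r }) ys⊆xs g

  Rho-functional : ∀ n {u} {s s′ : PF n} → Rho G n u s → Rho G n u s′ → s ≈ s′
  Rho-functional zero    _       _         = tt
  Rho-functional (suc n) (f , g) (f′ , g′) =
    All.map (λ { (y , e , r) → Any.map (Rho-functional n r) (f′ y e) }) g ,
    All.map (λ { (y , e , r) → Any.map (λ r′ → Rho-functional n r′ r) (f y e) }) g′

  Rho-bang : ∀ n {u} {s : PF (suc n)} → Rho G (suc n) u s → Rho G n u (bang n s)
  Rho-bang zero    _       = tt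
  Rho-bang (suc n) (f , g) =
    (λ y e → Any.map⁺ (Any.map (Rho-bang n) (f y e))) ,
    All.map⁺ (All.map (λ { (y , e , r) → y , e , Rho-bang n r }) g)

  Rho-transfer : (R : Node → Node → Set) →
    (∀ x y → R x y → ∀ x′ → Edge x x′ → ∃ λ y′ → Edge y y′ × R x′ y′) →
    (∀ x y → R x y → ∀ y′ → Edge y y′ → ∃ λ x′ → Edge x x′ × R x′ y′) →
    ∀ n {u v} {s : PF n} → R u v → Rho G n u s → Rho G n v s
  Rho-transfer R forth back zero    _   _       = tt
  Rho-transfer R forth back (suc n) {u} {v} uRv (f , g) =
    (λ v′ e → let u′ , e′ , u′Rv′ = back u v uRv v′ e in Any.map (Rho-transfer R forth back n u′Rv′) (f u′ e′)) ,
    All.map (λ { (u′ , e , r) → let v′ , e′ , u′Rv′ = forth u v uRv u′ e in v′ , e′ , Rho-transfer R forth back n u′Rv′ r }) g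

  SameRho-intro : ∀ n {u v} {s s′ : PF n} → Rho G n u s → Rho G n v s′ → s ≈ s′ → SameRho G n u v
  SameRho-intro n ρu ρv s≈s′ r = mk⇔ (λ ρu′ → Rho-resp n (≈-trans (≈-sym s≈s′) (Rho-functional n ρu ρu′)) ρv)
                                     (λ ρv′ → Rho-resp n (≈-trans s≈s′ (Rho-functional n ρv ρv′)) ρu)

length-∷ʳ : {A : Set} (us : List A) (a : A) → length (us ∷ʳ a) ≡ suc (length us)
length-∷ʳ us a = length-++-comm us (a ∷ [])

infix 4 _≋_
_≋_ : List Vω → List Vω → Set
_≋_ = Pointwise _≈ω_

≋-isEquivalence : IsEquivalence _≋_
≋-isEquivalence = Pointwise.isEquivalence ≈ω-isEquivalence

open IsEquivalence ≋-isEquivalence using () renaming (refl to ≋-refl; sym to ≋-sym; trans to ≋-trans)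
open IsEquivalence (Pointwise.isEquivalence ≋-isEquivalence) using () renaming (sym to ≋*-sym; trans to ≋*-trans)

endpoint : Vω → List Vω → Vω
endpoint x []       = x
endpoint x (y ∷ ys) = endpoint y ys

endpoint-∷ʳ : ∀ x us y → endpoint x (us ∷ʳ y) ≡ y
endpoint-∷ʳ x []       y = refl
endpoint-∷ʳ x (u ∷ us) y = endpoint-∷ʳ u us y

endpoint-cong : ∀ {x x′ us us′} → x ≈ω x′ → us ≋ us′ → endpoint x us ≈ω endpoint x′ us′
endpoint-cong x≈x′ []            = x≈x′
endpoint-cong _    (u≈u′ ∷ us≋) = endpoint-cong u≈u′ us≋

Chain-∷ʳ : ∀ x us {y} → Chain x us → endpoint x us ⇝ y → Chain x (us ∷ʳ y)
Chain-∷ʳ x []       _         x⇝y = x⇝y , tt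
Chain-∷ʳ x (u ∷ us) (x⇝u , c) e⇝y = x⇝u , Chain-∷ʳ u us c e⇝y

Chain-last : ∀ x us {y} → Chain x (us ∷ʳ y) → endpoint x us ⇝ y
Chain-last x []       (x⇝y , _) = x⇝y
Chain-last x (u ∷ us) (_ , c)   = Chain-last u us c

Chain-++⁻ˡ : ∀ x us vs → Chain x (us ++ vs) → Chain x us
Chain-++⁻ˡ x []       vs _         = tt
Chain-++⁻ˡ x (u ∷ us) vs (x⇝u , c) = x⇝u , Chain-++⁻ˡ u us vs c

Chain-resp : ∀ {x x′ us us′} → x ≈ω x′ → us ≋ us′ → Chain x us → Chain x′ us′
Chain-resp x≈x′ []            _         = tt
Chain-resp {x} {x′} {u ∷ _} {u′ ∷ _} x≈x′ (u≈u′ ∷ us≋) (x⇝u , c) =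
  ⇝-resp {x} {x′} {u} {u′} x≈x′ u≈u′ x⇝u , Chain-resp u≈u′ us≋ c

module TrProperties (x : Vω) where
  open RGraph (tr x)
  open RhoProperties (tr x)

  end : Node → Vω
  end u = endpoint x (proj₁ u)

  Edge-⇝ : ∀ u v → Edge u v → end u ⇝ end v
  Edge-⇝ (us , _) (vs , cv) (y , vs≋) =
    ⇝-resp {endpoint x us} {endpoint x us} {y} {endpoint x vs} (λ _ → ≈-refl) y≈end
      (Chain-last x us (Chain-resp (λ _ → ≈-refl) vs≋ cv))
    where
    y≈end : y ≈ω endpoint x vs
    y≈end n = ≈-sym (subst (λ z → seq (endpoint x vs) n ≈ seq z n) (endpoint-∷ʳ x us y)
                           (endpoint-cong (λ _ → ≈-refl) vs≋ n))

  child : (u : Node) (y : Vω) → end u ⇝ y → Node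
  child (us , cu) y u⇝y = us ∷ʳ y , Chain-∷ʳ x us cu u⇝y

  child-edge : ∀ u y (u⇝y : end u ⇝ y) → Edge u (child u y u⇝y)
  child-edge _ y _ = y , ≋-refl

  end-child : ∀ u y (u⇝y : end u ⇝ y) → end (child u y u⇝y) ≡ y
  end-child (us , _) y _ = endpoint-∷ʳ x us y

  Rho-end : ∀ n u → Rho (tr x) n u (seq (end u) n)
  Rho-end zero    u = tt
  Rho-end (suc n) u =
    (λ v u→v → Any.map (λ e≈ → Rho-resp n e≈ (Rho-end n v)) (Edge-⇝ u v u→v n)) ,
    All.tabulate λ e∈ →
      let y , u⇝y , yₙ≈e = ⇝-lift (end u) n (Any.map (λ { refl → ≈-refl }) e∈)
          v = child u y u⇝y
      in v , child-edge u y u⇝y ,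
         Rho-resp n (≈-trans (≈-reflexive (cong (λ z → seq z n) (end-child u y u⇝y))) yₙ≈e) (Rho-end n v)

  path-from : ∀ ps rs (cp : Chain x ps) v → proj₁ v ≋ ps ++ rs → Path (tr x) (ps , cp) v
  path-from ps []       cp v v≋ = stop (≋-sym (subst (proj₁ v ≋_) (++-identityʳ ps) v≋))
  path-from ps (r ∷ rs) cp v v≋ = step (r , ≋-refl) (path-from (ps ∷ʳ r) rs cp′ v v≋′)
    where
    v≋′ : proj₁ v ≋ (ps ∷ʳ r) ++ rs
    v≋′ = subst (proj₁ v ≋_) (sym (++-assoc ps (r ∷ []) rs)) v≋
    cp′ : Chain x (ps ∷ʳ r)
    cp′ = Chain-++⁻ˡ x (ps ∷ʳ r) rs (Chain-resp (λ _ → ≈-refl) v≋′ (proj₂ v))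

  extensions : List Vω → List Vω → List (List Vω)
  extensions us []       = []
  extensions us (r ∷ rs) = (us ∷ʳ r) ∷ extensions (us ∷ʳ r) rs

  extensions-cong : ∀ {us us′ rs rs′} → us ≋ us′ → rs ≋ rs′ →
    Pointwise _≋_ (extensions us rs) (extensions us′ rs′)
  extensions-cong us≋ []            = []
  extensions-cong us≋ (r≈r′ ∷ rs≋) = Pointwise.++⁺ us≋ (r≈r′ ∷ []) ∷ extensions-cong (Pointwise.++⁺ us≋ (r≈r′ ∷ [])) rs≋

  path-nodes : ∀ {u v} (p : Path (tr x) u v) → ∃ λ rs →
    proj₁ v ≋ proj₁ u ++ rs × Pointwise _≋_ (map proj₁ (pathNodes (tr x) p)) (extensions (proj₁ u) rs)
  path-nodes {us , _} {vs , _} (stop u≐v) = [] , subst (vs ≋_) (sym (++-identityʳ us)) (≋-sym u≐v) , []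
  path-nodes {us , _} {vs , _} (step (r , ys≋) p) with path-nodes p
  ... | rs , vs≋ , nodes≋ =
    r ∷ rs ,
    subst (vs ≋_) (++-assoc us (r ∷ []) rs) (≋-trans vs≋ (Pointwise.++⁺ ys≋ ≋-refl)) ,
    ys≋ ∷ ≋*-trans nodes≋ (extensions-cong ys≋ ≋-refl)

  isTree : IsTree (tr x)
  isTree = On.isEquivalence proj₁ ≋-isEquivalence ,
           (λ {u} {u′} {v} {v′} → Edge-resp {u} {u′} {v} {v′}) ,
           (λ v → path-from [] (proj₁ v) tt v ≋-refl) ,
           paths-unique
    where
    Edge-resp : ∀ {u u′ v v′} → u ≐ u′ → v ≐ v′ → Edge u v → Edge u′ v′
    Edge-resp u≐u′ v≐v′ (y , v≋) = y , ≋-trans (≋-sym v≐v′) (≋-trans v≋ (Pointwise.++⁺ u≐u′ ≋-refl))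
    paths-unique : ∀ v (p q : Path (tr x) root v) → Pointwise _≐_ (pathNodes (tr x) p) (pathNodes (tr x) q)
    paths-unique v p q with path-nodes p | path-nodes q
    ... | rs , v≋rs , p≋ | rs′ , v≋rs′ , q≋ =
      Pointwise.map⁻ proj₁ proj₁ (≋*-trans p≋ (≋*-trans (extensions-cong [] (≋-trans (≋-sym v≋rs) v≋rs′)) (≋*-sym q≋)))

  module _ (R : Node → Node → Set) (bisim : IsTreeBisim (tr x) R) where
    private
      forth        = proj₁ bisim
      back         = proj₁ (proj₂ bisim)
      only-root-ʳ  = proj₁ (proj₂ (proj₂ (proj₂ bisim)))
      only-root-ˡ  = proj₁ (proj₂ (proj₂ (proj₂ (proj₂ bisim))))
      parents      = proj₂ (proj₂ (proj₂ (proj₂ (proj₂ bisim))))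

    related-ends : ∀ {u v} → R u v → end u ≈ω end v
    related-ends {u} {v} uRv n = Rho-functional n (Rho-transfer R forth back n uRv (Rho-end n u)) (Rho-end n v)

    related-≐ : ∀ k u v → length (proj₁ u) ≡ k → R u v → u ≐ v
    related-≐ k (us₀ , cu) (vs₀ , cv) _ uRv with initLast us₀ | initLast vs₀
    related-≐ k (.[] , cu) (vs₀ , cv) _ uRv | [] | _ = ≋-sym (only-root-ʳ (vs₀ , cv) uRv)
    related-≐ k (.(us ∷ʳ a) , cu) (.[] , cv) _ uRv | us ∷ʳ′ a | [] = only-root-ˡ (us ∷ʳ a , cu) uRv
    related-≐ zero (.(us ∷ʳ a) , cu) _ len _ | us ∷ʳ′ a | _ ∷ʳ′ _ with () ← trans (sym (length-∷ʳ us a)) len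
    related-≐ (suc k) (.(us ∷ʳ a) , cu) (.(vs ∷ʳ b) , cv) len uRv | us ∷ʳ′ a | vs ∷ʳ′ b =
      Pointwise.++⁺ us≋vs (a≈b ∷ [])
      where
      pu pv : Node
      pu = us , Chain-++⁻ˡ x us (a ∷ []) cu
      pv = vs , Chain-++⁻ˡ x vs (b ∷ []) cv
      us≋vs : us ≋ vs
      us≋vs = related-≐ k pu pv (suc-injective (trans (sym (length-∷ʳ us a)) len))
                (parents _ _ pu pv uRv (a , ≋-refl) (b , ≋-refl))
      a≈b : a ≈ω b
      a≈b n = subst₂ (λ a′ b′ → seq a′ n ≈ seq b′ n) (endpoint-∷ʳ x us a) (endpoint-∷ʳ x vs b) (related-ends uRv n)

  stronglyExtensional : StronglyExtensional (tr x)
  stronglyExtensional R bisim u v = related-≐ R bisim _ u v refl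

sublists : {A : Set} → List A → List (List A)
sublists []       = [] ∷ []
sublists (x ∷ xs) = sublists xs ++ map (x ∷_) (sublists xs)

filter-∈-sublists : {A : Set} {P : A → Set} (P? : Decidable P) (xs : List A) → filter P? xs ∈ sublists xs
filter-∈-sublists P? []       = here refl
filter-∈-sublists P? (x ∷ xs) with does (P? x)
... | true  = ∈-++⁺ʳ (sublists xs) (∈-map⁺ (x ∷_) (filter-∈-sublists P? xs))
... | false = ∈-++⁺ˡ (filter-∈-sublists P? xs)

Infinite : (ℕ → Set) → Set
Infinite Q = ∀ m → ∃ λ p → p ≥ m × Q p

module Classical (em : ExcludedMiddle 0ℓ) where

  enum : ∀ n → List (PF n)
  enum zero    = tt ∷ []
  enum (suc n) = sublists (enum n)

  -- c is ≈ to the sublist of enum n of the elements that lie in c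
  enum-complete : ∀ n (c : PF n) → Any (c ≈_) (enum n)
  enum-complete zero    c = here tt
  enum-complete (suc n) c = lose (filter-∈-sublists (λ _ → em) (enum n)) (c⊆s , s⊆c)
    where
    s = filter (λ e → em {e ∈PF c}) (enum n)
    c⊆s : All (_∈PF s) c
    c⊆s = All.tabulate λ b∈c →
      let e , e∈enum , b≈e = find (enum-complete n _ ) in
      lose (∈-filter⁺ (λ _ → em) e∈enum (Any.map (λ { refl → ≈-sym b≈e }) b∈c)) b≈e
    s⊆c : All (λ e → Any (_≈ e) c) s
    s⊆c = All.map (Any.map ≈-sym) (All.all-filter (λ _ → em) (enum n))

  Rho-exists : (G : RGraph) → ∀ n u → Σ (PF n) (Rho G n u)
  Rho-exists G zero    u = tt , tt
  Rho-exists G (suc n) u = filter (λ _ → em) (enum n) , children-covered , All.all-filter (λ _ → em) (enum n)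
    where
    open RGraph G
    children-covered : ∀ y → Edge u y → Any (Rho G n y) (filter (λ _ → em) (enum n))
    children-covered y u→y =
      let s , ρy = Rho-exists G n y
          e , e∈enum , s≈e = find (enum-complete n s)
          ρy′ = RhoProperties.Rho-resp G n s≈e ρy
      in lose (∈-filter⁺ (λ _ → em) e∈enum (y , u→y , ρy′)) ρy′

  eventually-not : ∀ {Q : ℕ → Set} → ¬ Infinite Q → ∃ λ m → ∀ p → p ≥ m → ¬ Q p
  eventually-not {Q} ¬inf with em {∃ λ m → ∀ p → p ≥ m → ¬ Q p}
  ... | yes ev = ev
  ... | no ¬ev = ⊥-elim (¬inf λ m → em⇒dne em λ ¬q → ¬ev (m , λ p p≥m q → ¬q (p , p≥m , q)))

  pigeonhole : ∀ {n} (I : ℕ → Set) (g : ℕ → PF n) (es : List (PF n)) (m₀ : ℕ) → Infinite I →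
    (∀ p → p ≥ m₀ → I p → Any (g p ≈_) es) → Any (λ e → Infinite (λ p → I p × g p ≈ e)) es
  pigeonhole I g []       m₀ inf covered with inf m₀
  ... | p , p≥m₀ , Ip with () ← covered p p≥m₀ Ip
  pigeonhole I g (e ∷ es) m₀ inf covered with em {Infinite (λ p → I p × g p ≈ e)}
  ... | yes inf-e = here inf-e
  ... | no ¬inf-e with eventually-not ¬inf-e
  ...   | m₁ , avoid-e = there (pigeonhole I g es (m₀ ⊔ m₁) inf covered′)
    where
    covered′ : ∀ p → p ≥ m₀ ⊔ m₁ → I p → Any (g p ≈_) es
    covered′ p p≥ Ip with covered p (≤-trans (m≤m⊔n m₀ m₁) p≥) Ip
    ... | here ge  = ⊥-elim (avoid-e p (≤-trans (m≤n⊔m m₀ m₁) p≥) (Ip , ge))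
    ... | there g∈ = g∈

  refine : (b : ℕ → Vω) (n : ℕ) {c : PF n} → Infinite (λ p → seq (b p) n ≈ c) →
    ∃ λ c′ → Infinite (λ p → seq (b p) (suc n) ≈ c′) × bang n c′ ≈ c
  refine b n {c} inf
    with Any.satisfied (pigeonhole (λ p → seq (b p) n ≈ c) (λ p → seq (b p) (suc n)) (enum (suc n)) 0 inf
                                   (λ p _ _ → enum-complete (suc n) (seq (b p) (suc n))))
  ... | c′ , inf′ =
    c′ , (λ m → let p , p≥m , _ , bₚ≈c′ = inf′ m in p , p≥m , bₚ≈c′) ,
    (let p , _ , bₚ≈c , bₚ≈c′ = inf′ 0 in ≈-trans (bang-cong n (≈-sym bₚ≈c′)) (≈-trans (coh (b p) n) bₚ≈c))

  module Accumulation (b : ℕ → Vω) where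

    level : ∀ n → Σ (PF n) λ c → Infinite (λ p → seq (b p) n ≈ c)
    level zero    = tt , λ m → m , ≤-refl , tt
    level (suc n) = let c′ , inf′ , _ = refine b n (proj₂ (level n)) in c′ , inf′

    point : Vω
    seq point n = proj₁ (level n)
    coh point n = proj₂ (proj₂ (refine b n (proj₂ (level n))))

    index : ℕ → ℕ
    index zero    = 0
    index (suc k) = proj₁ (proj₂ (level (suc k)) (suc (index k)))

    index-increasing : ∀ k → index k < index (suc k)
    index-increasing k = proj₁ (proj₂ (proj₂ (level (suc k)) (suc (index k))))

    index-agrees : ∀ k → seq (b (index k)) k ≈ seq point k
    index-agrees zero    = tt
    index-agrees (suc k) = proj₂ (proj₂ (proj₂ (level (suc k)) (suc (index k))))

  accumulation-point : (b : ℕ → Vω) →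
    Σ (ℕ → ℕ) λ f → (∀ k → f k < f (suc k)) × ∃ λ c → ∀ k → seq (b (f k)) k ≈ seq c k
  accumulation-point b = index , index-increasing , point , index-agrees
    where open Accumulation b

  compactlyBranching : ∀ x → CompactlyBranching (tr x)
  compactlyBranching x u ys u→ys with accumulation-point (λ k → TrProperties.end x (ys k))
  ... | f , f-increasing , c , agrees = f , f-increasing , child u c u⇝c , child-edge u c u⇝c , limit
    where
    open TrProperties x
    open RhoProperties (tr x)
    u⇝c : end u ⇝ c
    u⇝c n = ∈PF-resp (agrees n) ≈-refl (Edge-⇝ u (ys (f n)) (u→ys (f n)) n)
    limit : Lim (tr x) (λ k → ys (f k)) (child u c u⇝c)
    limit n = n , λ p p≥n → SameRho-intro n (Rho-end n (ys (f p))) (Rho-end n (child u c u⇝c))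
      (≈-trans (≈-below (end (ys (f p))) c (≤⇒≤′ p≥n) (agrees p))
               (≈-reflexive (cong (λ z → seq z n) (sym (end-child u c u⇝c)))))

  ρ : (G : RGraph) → RGraph.Node G → Vω
  seq (ρ G u) n = proj₁ (Rho-exists G n u)
  coh (ρ G u) n = Rho-functional n (Rho-bang n (proj₂ (Rho-exists G (suc n) u))) (proj₂ (Rho-exists G n u))
    where open RhoProperties G

BarrEquivalent-intro : (G H : RGraph) →
  (∀ n → ∃ λ s → Rho G n (RGraph.root G) s × Rho H n (RGraph.root H) s) → BarrEquivalent G H
BarrEquivalent-intro G H common n s =
  mk⇔ (λ ρG → H.Rho-resp n (G.Rho-functional n ρ₁ ρG) ρ₂) (λ ρH → G.Rho-resp n (H.Rho-functional n ρ₂ ρH) ρ₁)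
  where
  module G = RhoProperties G
  module H = RhoProperties H
  ρ₁ = proj₁ (proj₂ (common n))
  ρ₂ = proj₂ (proj₂ (common n))

lemmaA12 : ExcludedMiddle 0ℓ →
    (t : RGraph) → IsTree t →
    Σ Vω (λ x → IsTree (tr x) × StronglyExtensional (tr x) ×
                CompactlyBranching (tr x) × BarrEquivalent (tr x) t)
-- IsTree t is not needed: only the ρ-values at the root of t are used.
lemmaA12 em t _ =
  x , isTree , stronglyExtensional , compactlyBranching x ,
  BarrEquivalent-intro (tr x) t (λ n → seq x n , Rho-end n root , proj₂ (Rho-exists t n (RGraph.root t)))
  where
  open Classical em
  x : Vω
  x = ρ t (RGraph.root t)
  open TrProperties x
  open RGraph (tr x) using (root)
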